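{- Let $\mathfrak{X}=(\Omega,\mathcal{C}=\{C_0=1_\Omega,C_1,C_2,C_3,C_4\})$ be a symmetric homogeneous rainbow of $\Omega^2$ and put $C:=C_2\cup C_3\cup C_4$. Assume that for every $i\in\{2,3,4\}$ the partition $\{C_0,C_1,C_i,C\setminus C_i\}$ of $\Omega^2$ is an association scheme. Then $\mathfrak{X}$ is a Jordan scheme.
   Context: For $R\subseteq\Omega^2$: $R(\alpha)=\{\beta:(\alpha,\beta)\in R\}$, $R^\top$ the transpose. A rainbow is a partition $\mathcal{C}$ of $\Omega^2$ such that $1_\Omega=\{(\omega,\omega)\}$ is a union of classes and $C^\top\in\mathcal{C}$ for all $C$; homogeneous means $1_\Omega\in\mathcal{C}$; symmetric means all classes are symmetric. An association scheme is a homogeneous rainbow in which $|C(\alpha)\cap D^\top(\beta)|$ depends only on the class of $(\alpha,\beta)$ for all classes $C,D$. A Jordan scheme is a homogeneous rainbow such that for all classes $C,D$ and all pairs $(\alpha,\beta),(\alpha',\beta')$ in the same class, $|C(\alpha)\cap D^\top(\beta)|+|D(\alpha)\cap C^\top(\beta)|=|C(\alpha')\cap D^\top(\beta')|+|D(\alpha')\cap C^\top(\beta')|$. -}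

module Defs where

open import Data.Nat using (ℕ; zero; suc; _+_)
open import Data.Fin using (Fin; zero; suc)
open import Data.Fin.Properties using (_≟_)
open import Data.Product using (Σ; ∃; _×_; _,_)
open import Relation.Nullary using (Dec; yes; no)
open import Relation.Binary.PropositionalEquality using (_≡_)

-- A partition of Ω² (Ω = Fin n) into k classes indexed by Fin k,
-- given by the colour map: (α,β) lies in class c α β.
Coloring : ℕ → ℕ → Set
Coloring n k = Fin n → Fin n → Fin k

count : ∀ {n} {P : Fin n → Set} → ((x : Fin n) → Dec (P x)) → ℕ
count {zero} d = 0
count {suc n} d with d zero
... | yes _ = suc (count (λ x → d (suc x)))
... | no _ = count (λ x → d (suc x))

-- |C_i(α) ∩ C_j^⊤(β)| = #{γ : (α,γ) ∈ C_i and (γ,β) ∈ C_j}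
inter : ∀ {n k} → Coloring n k → Fin k → Fin k → Fin n → Fin n → ℕ
inter c i j α β = count (λ γ → dec (c α γ ≟ i) (c γ β ≟ j))
  where
  dec : ∀ {A B : Set} → Dec A → Dec B → Dec (A × B)
  dec (yes a) (yes b) = yes (a , b)
  dec (no ¬a) _ = no (λ { (a , _) → ¬a a })
  dec (yes _) (no ¬b) = no (λ { (_ , b) → ¬b b })

-- Rainbow: every class nonempty (it is a partition), 1_Ω is a union of
-- classes, and the transpose of every class is a class.
record IsRainbow {n k} (c : Coloring n k) : Set where
  field
    nonempty : ∀ i → Σ (Fin n) λ α → Σ (Fin n) λ β → c α β ≡ i
    diagUnion : ∀ α β γ → c α β ≡ c γ γ → α ≡ β
    transpose : ∀ i → Σ (Fin k) λ j → ∀ α β → c α β ≡ i → c β α ≡ j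

record IsHomogeneousRainbow {n k} (c : Coloring n k) : Set where
  field
    rainbow : IsRainbow c
    diagClass : ∀ α β → c α α ≡ c β β

IsSymmetric : ∀ {n k} → Coloring n k → Set
IsSymmetric c = ∀ α β → c α β ≡ c β α

record IsAssociationScheme {n k} (c : Coloring n k) : Set where
  field
    homogeneous : IsHomogeneousRainbow c
    regular : ∀ i j α β α' β' → c α β ≡ c α' β' →
              inter c i j α β ≡ inter c i j α' β'

record IsJordanScheme {n k} (c : Coloring n k) : Set where
  field
    homogeneous : IsHomogeneousRainbow c
    jordan : ∀ i j α β α' β' → c α β ≡ c α' β' →
             inter c i j α β + inter c j i α β ≡ inter c i j α' β' + inter c j i α' β'

-- The partition {C_0, C_1, C_i, C \ C_i} (C = C_2 ∪ C_3 ∪ C_4) obtained by merging: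
-- classes 0,1 kept, class i becomes class 2, the other two of {2,3,4} become class 3.
merge : Fin 5 → Fin 5 → Fin 4
merge i zero = zero
merge i (suc zero) = suc zero
merge i j with i ≟ j
... | yes _ = suc (suc zero)
... | no _ = suc (suc (suc zero))

-- Each Jordan sum |C_i(α) ∩ C_j^⊤(β)| + |C_j(α) ∩ C_i^⊤(β)| counts the paths α → γ → β weighted
-- by δ_ij + δ_ji on the colours of the two edges, so it suffices that these weights have
-- path counts constant on colour classes.  A merged scheme in which i and j remain classes
-- gives this for δ_ij and δ_ji separately; this covers every pair except two distinct
-- i, j ∈ {2,3,4}.  For those, the scheme merging i and j into one class gives constancy of
-- (δ_i + δ_j) ⊗ (δ_i + δ_j) = δ_ii + δ_jj + (δ_ij + δ_ji), and δ_ii, δ_jj are already known.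
module Submission where

open import Defs
open import Data.Nat using (ℕ; zero; suc; _+_; _*_)
open import Data.Nat.Properties using (+-0-commutativeMonoid; +-cancelˡ-≡; +-comm)
open import Data.Nat.Tactic.RingSolver using (solve-∀)
open import Data.Fin using (Fin; zero; suc)
open import Data.Fin.Patterns using (0F; 1F; 2F; 3F; 4F)
open import Data.Fin.Properties using (_≟_)
open import Data.Product using (Σ-syntax; _×_; _,_)
open import Data.Sum using (_⊎_; inj₁; inj₂)
open import Data.Empty using (⊥-elim)
open import Relation.Nullary using (Dec; yes; no)
open import Relation.Binary.PropositionalEquality
  using (_≡_; refl; sym; trans; cong; cong₂; module ≡-Reasoning)

open import Algebra.Properties.CommutativeMonoid.Sum +-0-commutativeMonoid
  using (sum; sum-cong-≗; ∑-distrib-+)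

indicator : ∀ {A : Set} → Dec A → ℕ
indicator (yes _) = 1
indicator (no _) = 0

indicator-× : ∀ {A B : Set} (a? : Dec A) (b? : Dec B) (ab? : Dec (A × B)) →
              indicator ab? ≡ indicator a? * indicator b?
indicator-× (yes a) (yes b) (yes _) = refl
indicator-× (yes a) (yes b) (no ¬ab) = ⊥-elim (¬ab (a , b))
indicator-× (yes _) (no _) (no _) = refl
indicator-× (yes _) (no ¬b) (yes (_ , b)) = ⊥-elim (¬b b)
indicator-× (no _) _ (no _) = refl
indicator-× (no ¬a) _ (yes (a , _)) = ⊥-elim (¬a a)

count≡sum : ∀ {n} {P : Fin n → Set} (P? : (x : Fin n) → Dec (P x)) →
            count P? ≡ sum (λ x → indicator (P? x))
count≡sum {zero} P? = refl
count≡sum {suc n} P? with P? zero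
... | yes _ = cong suc (count≡sum (λ x → P? (suc x)))
... | no _ = count≡sum (λ x → P? (suc x))

δ : ∀ {k} → Fin k → Fin k → ℕ
δ a u = indicator (u ≟ a)

δ₂ : ∀ {k} → Fin k → Fin k → Fin k → Fin k → ℕ
δ₂ a b u v = δ a u * δ b v

_⊕_ : ∀ {k} → (Fin k → Fin k → ℕ) → (Fin k → Fin k → ℕ) → Fin k → Fin k → ℕ
(w ⊕ w') u v = w u v + w' u v

module PathCounts {n k} (c : Coloring n k) where

  paths : (Fin k → Fin k → ℕ) → Fin n → Fin n → ℕ
  paths w α β = sum (λ γ → w (c α γ) (c γ β))

  record Invariant (w : Fin k → Fin k → ℕ) : Set where
    constructor invariant
    field constant : ∀ α β α' β' → c α β ≡ c α' β' → paths w α β ≡ paths w α' β'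

  open Invariant public

  inter≡paths : ∀ i j α β → inter c i j α β ≡ paths (δ₂ i j) α β
  inter≡paths i j α β =
    trans (count≡sum {n} _) (sum-cong-≗ (λ γ → indicator-× (c α γ ≟ i) (c γ β ≟ j) _))

  paths-cong : ∀ {w w'} → (∀ u v → w u v ≡ w' u v) → ∀ α β → paths w α β ≡ paths w' α β
  paths-cong w≗w' α β = sum-cong-≗ (λ γ → w≗w' (c α γ) (c γ β))

  paths-⊕ : ∀ w w' α β → paths (w ⊕ w') α β ≡ paths w α β + paths w' α β
  paths-⊕ w w' α β = ∑-distrib-+ (λ γ → w (c α γ) (c γ β)) (λ γ → w' (c α γ) (c γ β))

  invariant-resp : ∀ {w w'} → (∀ u v → w u v ≡ w' u v) → Invariant w → Invariant w'
  invariant-resp w≗w' inv = invariant λ α β α' β' eq →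
    trans (sym (paths-cong w≗w' α β)) (trans (constant inv α β α' β' eq) (paths-cong w≗w' α' β'))

  invariant-⊕ : ∀ {w w'} → Invariant w → Invariant w' → Invariant (w ⊕ w')
  invariant-⊕ {w} {w'} inv inv' = invariant λ α β α' β' eq → begin
    paths (w ⊕ w') α β              ≡⟨ paths-⊕ w w' α β ⟩
    paths w α β + paths w' α β      ≡⟨ cong₂ _+_ (constant inv α β α' β' eq) (constant inv' α β α' β' eq) ⟩
    paths w α' β' + paths w' α' β'  ≡⟨ paths-⊕ w w' α' β' ⟨
    paths (w ⊕ w') α' β'            ∎
    where open ≡-Reasoning

  invariant-cancelˡ : ∀ {w w'} → Invariant w → Invariant (w ⊕ w') → Invariant w'
  invariant-cancelˡ {w} {w'} inv inv⊕ = invariant λ α β α' β' eq → +-cancelˡ-≡ (paths w α β) _ _ (begin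
    paths w α β + paths w' α β      ≡⟨ paths-⊕ w w' α β ⟨
    paths (w ⊕ w') α β              ≡⟨ constant inv⊕ α β α' β' eq ⟩
    paths (w ⊕ w') α' β'            ≡⟨ paths-⊕ w w' α' β' ⟩
    paths w α' β' + paths w' α' β'  ≡⟨ cong (_+ paths w' α' β') (constant inv α β α' β' eq) ⟨
    paths w α β + paths w' α' β'    ∎)
    where open ≡-Reasoning

  invariant-⊕-comm : ∀ w w' → Invariant (w ⊕ w') → Invariant (w' ⊕ w)
  invariant-⊕-comm w w' = invariant-resp (λ u v → +-comm (w u v) (w' u v))

  jordan-sum≡paths : ∀ i j α β → inter c i j α β + inter c j i α β ≡ paths (δ₂ i j ⊕ δ₂ j i) α β
  jordan-sum≡paths i j α β =
    trans (cong₂ _+_ (inter≡paths i j α β) (inter≡paths j i α β)) (sym (paths-⊕ (δ₂ i j) (δ₂ j i) α β))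

  invariant⇒jordan : IsHomogeneousRainbow c → (∀ i j → Invariant (δ₂ i j ⊕ δ₂ j i)) → IsJordanScheme c
  invariant⇒jordan hom inv = record
    { homogeneous = hom
    ; jordan = λ i j α β α' β' eq →
        trans (jordan-sum≡paths i j α β)
          (trans (constant (inv i j) α β α' β' eq) (sym (jordan-sum≡paths i j α' β')))
    }

open PathCounts

Isolates : ∀ {k m} → (Fin k → Fin m) → Fin k → Set
Isolates f j = ∀ u → f u ≡ f j → u ≡ j

module _ {n k m} (c : Coloring n k) (f : Fin k → Fin m)
         (scheme : IsAssociationScheme (λ α β → f (c α β))) where

  scheme⇒invariant : ∀ a b → Invariant c (λ u v → δ₂ a b (f u) (f v))
  scheme⇒invariant a b = invariant λ α β α' β' eq →
    trans (sym (inter≡paths _ a b α β))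
      (trans (IsAssociationScheme.regular scheme a b α β α' β' (cong f eq)) (inter≡paths _ a b α' β'))

  δ-isolated : ∀ {j} → Isolates f j → ∀ u → δ (f j) (f u) ≡ δ j u
  δ-isolated {j} iso u with u ≟ j | f u ≟ f j
  ... | yes _ | yes _ = refl
  ... | yes refl | no fu≢fj = ⊥-elim (fu≢fj refl)
  ... | no u≢j | yes fu≡fj = ⊥-elim (u≢j (iso u fu≡fj))
  ... | no _ | no _ = refl

  isolated-invariant : ∀ {j l} → Isolates f j → Isolates f l → Invariant c (δ₂ j l)
  isolated-invariant isoj isol =
    invariant-resp c (λ u v → cong₂ _*_ (δ-isolated isoj u) (δ-isolated isol v))
      (scheme⇒invariant (f _) (f _))

  isolated-jordan-invariant : ∀ {j l} → Isolates f j → Isolates f l → Invariant c (δ₂ j l ⊕ δ₂ l j)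
  isolated-jordan-invariant isoj isol =
    invariant-⊕ c (isolated-invariant isoj isol) (isolated-invariant isol isoj)

  fibre-jordan-invariant : ∀ {b j l} → (∀ u → δ b (f u) ≡ δ j u + δ l u) →
    Invariant c (δ₂ j j) → Invariant c (δ₂ l l) → Invariant c (δ₂ j l ⊕ δ₂ l j)
  fibre-jordan-invariant {b} {j} {l} fibre invj invl =
    invariant-cancelˡ c (invariant-⊕ c invj invl) (invariant-resp c expand (scheme⇒invariant b b))
    where
    square : ∀ x y z t → (x + y) * (z + t) ≡ (x * z + y * t) + (x * t + y * z)
    square = solve-∀
    expand : ∀ u v → δ₂ b b (f u) (f v) ≡ ((δ₂ j j ⊕ δ₂ l l) ⊕ (δ₂ j l ⊕ δ₂ l j)) u v
    expand u v = trans (cong₂ _*_ (fibre u) (fibre v)) (square (δ j u) (δ l u) (δ j v) (δ l v))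

merge-isolates-0F : ∀ i → Isolates (merge i) 0F
merge-isolates-0F i 0F _ = refl
merge-isolates-0F i (suc (suc u)) eq with i ≟ suc (suc u)
merge-isolates-0F i (suc (suc u)) () | yes _
merge-isolates-0F i (suc (suc u)) () | no _

merge-isolates-1F : ∀ i → Isolates (merge i) 1F
merge-isolates-1F i 1F _ = refl
merge-isolates-1F i (suc (suc u)) eq with i ≟ suc (suc u)
merge-isolates-1F i (suc (suc u)) () | yes _
merge-isolates-1F i (suc (suc u)) () | no _

merge-isolates-self : ∀ i → Isolates (merge (suc (suc i))) (suc (suc i))
merge-isolates-self i u eq with suc (suc i) ≟ suc (suc i)
... | no i≢i = ⊥-elim (i≢i refl)
... | yes _ = isolates u eq
  where
  isolates : ∀ u → merge (suc (suc i)) u ≡ 2F → u ≡ suc (suc i)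
  isolates (suc (suc u)) eq with suc (suc i) ≟ suc (suc u)
  ... | yes i≡u = sym i≡u
  isolates (suc (suc u)) () | no _

merge-fibre-2F : ∀ u → δ 3F (merge 2F u) ≡ δ 3F u + δ 4F u
merge-fibre-2F 0F = refl
merge-fibre-2F 1F = refl
merge-fibre-2F 2F = refl
merge-fibre-2F 3F = refl
merge-fibre-2F 4F = refl

merge-fibre-3F : ∀ u → δ 3F (merge 3F u) ≡ δ 2F u + δ 4F u
merge-fibre-3F 0F = refl
merge-fibre-3F 1F = refl
merge-fibre-3F 2F = refl
merge-fibre-3F 3F = refl
merge-fibre-3F 4F = refl

merge-fibre-4F : ∀ u → δ 3F (merge 4F u) ≡ δ 2F u + δ 3F u
merge-fibre-4F 0F = refl
merge-fibre-4F 1F = refl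
merge-fibre-4F 2F = refl
merge-fibre-4F 3F = refl
merge-fibre-4F 4F = refl

MergedScheme : ∀ {n} → Coloring n 5 → Fin 5 → Set
MergedScheme c i = IsAssociationScheme (λ α β → merge i (c α β))

module _ {n} (c : Coloring n 5) (scheme₂ : MergedScheme c 2F) (scheme₃ : MergedScheme c 3F)
         (scheme₄ : MergedScheme c 4F) where

  isolating-scheme : ∀ j → Σ[ i ∈ Fin 5 ] MergedScheme c i × Isolates (merge i) j
  isolating-scheme 0F = 2F , scheme₂ , merge-isolates-0F 2F
  isolating-scheme 1F = 2F , scheme₂ , merge-isolates-1F 2F
  isolating-scheme 2F = 2F , scheme₂ , merge-isolates-self 0F
  isolating-scheme 3F = 3F , scheme₃ , merge-isolates-self 1F
  isolating-scheme 4F = 4F , scheme₄ , merge-isolates-self 2F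

  diagonal-invariant : ∀ j → Invariant c (δ₂ j j)
  diagonal-invariant j with isolating-scheme j
  ... | i , scheme , iso = isolated-invariant c (merge i) scheme iso iso

  isolated-everywhere-jordan-invariant : ∀ j l → (∀ i → Isolates (merge i) l) →
    Invariant c (δ₂ j l ⊕ δ₂ l j)
  isolated-everywhere-jordan-invariant j l isoₗ with isolating-scheme j
  ... | i , scheme , isoⱼ = isolated-jordan-invariant c (merge i) scheme isoⱼ (isoₗ i)

  jordan-invariant : ∀ j l → Invariant c (δ₂ j l ⊕ δ₂ l j)
  jordan-invariant j 0F = isolated-everywhere-jordan-invariant j 0F merge-isolates-0F
  jordan-invariant j 1F = isolated-everywhere-jordan-invariant j 1F merge-isolates-1F
  jordan-invariant 0F l =
    invariant-⊕-comm c (δ₂ l 0F) (δ₂ 0F l) (isolated-everywhere-jordan-invariant l 0F merge-isolates-0F)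
  jordan-invariant 1F l =
    invariant-⊕-comm c (δ₂ l 1F) (δ₂ 1F l) (isolated-everywhere-jordan-invariant l 1F merge-isolates-1F)
  jordan-invariant 2F 2F = invariant-⊕ c (diagonal-invariant 2F) (diagonal-invariant 2F)
  jordan-invariant 3F 3F = invariant-⊕ c (diagonal-invariant 3F) (diagonal-invariant 3F)
  jordan-invariant 4F 4F = invariant-⊕ c (diagonal-invariant 4F) (diagonal-invariant 4F)
  jordan-invariant 2F 3F =
    fibre-jordan-invariant c (merge 4F) scheme₄ merge-fibre-4F (diagonal-invariant 2F) (diagonal-invariant 3F)
  jordan-invariant 2F 4F =
    fibre-jordan-invariant c (merge 3F) scheme₃ merge-fibre-3F (diagonal-invariant 2F) (diagonal-invariant 4F)
  jordan-invariant 3F 4F =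
    fibre-jordan-invariant c (merge 2F) scheme₂ merge-fibre-2F (diagonal-invariant 3F) (diagonal-invariant 4F)
  jordan-invariant 3F 2F = invariant-⊕-comm c (δ₂ 2F 3F) (δ₂ 3F 2F) (jordan-invariant 2F 3F)
  jordan-invariant 4F 2F = invariant-⊕-comm c (δ₂ 2F 4F) (δ₂ 4F 2F) (jordan-invariant 2F 4F)
  jordan-invariant 4F 3F = invariant-⊕-comm c (δ₂ 3F 4F) (δ₂ 4F 3F) (jordan-invariant 3F 4F)

proposition3p6 : (n : ℕ) (c : Coloring n 5) →
    IsHomogeneousRainbow c →
    IsSymmetric c →
    (∀ α β → (c α β ≡ zero → α ≡ β) × (α ≡ β → c α β ≡ zero)) →
    (∀ (i : Fin 5) → ((i ≡ suc (suc zero)) ⊎ (i ≡ suc (suc (suc zero))) ⊎ (i ≡ suc (suc (suc (suc zero))))) →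
    IsAssociationScheme (λ α β → merge i (c α β))) →
    IsJordanScheme c
proposition3p6 n c homogeneous _ _ scheme =
  invariant⇒jordan c homogeneous
    (jordan-invariant c (scheme 2F (inj₁ refl)) (scheme 3F (inj₂ (inj₁ refl))) (scheme 4F (inj₂ (inj₂ refl))))
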